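{- Let $S$ be a set of positive integers with $|S|\le 2$. Then there is a sequence $(x_n)_{n\ge 1}$ with each $x_n\in\{+1,-1\}$ such that $\left|\sum_{i=1}^{k} x_{is}\right|\le 1$ for every $s\in S$ and every integer $k\ge 1$.
   Context: For a sequence $(x_n)_{n\ge1}\in\{\pm1\}^{\mathbb{Z}^+}$, the partial sums $d(s,k)=\sum_{i=1}^k x_{is}$ are the sums along the homogeneous arithmetic progression $s,2s,3s,\dots$; "2-coloring $\mathbb{N}$ with discrepancy 1 with respect to the homogeneous arithmetic progressions with skip sizes in $S$" means choosing such a sequence with $|d(s,k)|\le 1$ for all $s\in S$, $k\ge1$. -}

module Defs where

open import Data.Nat using (ℕ; zero; suc; _*_)
open import Data.Integer using (ℤ; +_; -_; _+_; ∣_∣)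
open import Data.Sum using (_⊎_)
open import Relation.Binary.PropositionalEquality using (_≡_)

-- A ±1 sequence indexed by positive integers: x (suc n) is x_{n+1};
-- the value x 0 is irrelevant (never used).
IsSignSeq : (ℕ → ℤ) → Set
IsSignSeq x = ∀ n → (x (suc n) ≡ + 1) ⊎ (x (suc n) ≡ - (+ 1))

d : (ℕ → ℤ) → ℕ → ℕ → ℤ
d x s zero    = + 0
d x s (suc k) = d x s k + x (suc k * s)

-- Along a skip size s, the partial sums stay in {-1,0,1} as soon as the terms at
-- (2i+1)s and (2i+2)s are opposite signs. For odd s the alternating sequence
-- (-1)^(n+1) does this, since m s and m have the same parity. If s is odd and t
-- even, put x_{mt} = (-1)^(m+1) on the even numbers (which contain every multiple
-- of t) and set each odd n to the negative of x_{n+s}; because n+s is even, this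
-- is consistent, and along s it pairs (2i+1)s with (2i+2)s. Finally, if both s and
-- t are even, a colouring for s/2, t/2 is stretched to x'_n = x_{⌊n/2⌋}.
module Submission where

open import Defs
open import Data.Nat using (ℕ; suc; _≤_)
open import Data.Integer using (ℤ; ∣_∣)
open import Data.List using (List; length)
open import Data.List.Membership.Propositional using (_∈_)
open import Data.List.Relation.Unary.All using (All)
open import Data.Product using (Σ; _×_)

open import Data.Nat as ℕ using (zero; z≤n; s≤s; _<_; NonZero; >-nonZero; ⌊_/2⌋; parity)
open import Data.Nat.Properties using (*-assoc; ⌊n/2⌋<n)
open import Data.Nat.DivMod using (_/_; m*n/n≡m)
open import Data.Nat.Induction using (<-wellFounded)
open import Induction.WellFounded using (Acc; acc)
open import Data.Parity.Base as ℙ using (Parity; 0ℙ; 1ℙ; _⁻¹)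
open import Data.Parity.Properties using (*-homo-*; *-zeroʳ; *-identityʳ)
open import Data.Integer as ℤ using (+_; -_)
open import Data.Integer.Properties using (+-assoc; +-identityˡ; +-inverseˡ)
open import Data.List using ([]; _∷_; map)
open import Data.List.Relation.Unary.All as All using ([]; _∷_)
open import Data.List.Relation.Unary.All.Properties using (map⁺)
open import Data.Product using (_,_; proj₁; proj₂)
open import Data.Sum using (_⊎_; inj₁; inj₂)
open import Relation.Binary.PropositionalEquality
  using (_≡_; refl; sym; trans; cong; cong₂; subst; module ≡-Reasoning)

IsSign : ℤ → Set
IsSign z = z ≡ + 1 ⊎ z ≡ - + 1

IsSign-neg : ∀ {z} → IsSign z → IsSign (- z)
IsSign-neg (inj₁ refl) = inj₂ refl
IsSign-neg (inj₂ refl) = inj₁ refl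

IsSign⇒∣∣≤1 : ∀ {z} → IsSign z → ∣ z ∣ ≤ 1
IsSign⇒∣∣≤1 (inj₁ refl) = s≤s z≤n
IsSign⇒∣∣≤1 (inj₂ refl) = s≤s z≤n

Disc≤1 : (ℕ → ℤ) → ℕ → Set
Disc≤1 x s = ∀ k → ∣ d x s k ∣ ≤ 1

-- Signs are demanded at the unused position 0 too, so that stretching preserves them.
Colouring : List ℕ → Set
Colouring S = Σ (ℕ → ℤ) λ x → (∀ n → IsSign (x n)) × All (Disc≤1 x) S

parity-suc : ∀ n {p} → parity n ≡ p → parity (suc n) ≡ p ⁻¹
parity-suc zero          refl = refl
parity-suc (suc zero)    refl = refl
parity-suc (suc (suc n)) pn   = parity-suc n pn

parity-* : ∀ m n {p q} → parity m ≡ p → parity n ≡ q → parity (m ℕ.* n) ≡ p ℙ.* q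
parity-* m n refl refl = *-homo-* m n

even⇒⌊n/2⌋*2≡n : ∀ n → parity n ≡ 0ℙ → ⌊ n /2⌋ ℕ.* 2 ≡ n
even⇒⌊n/2⌋*2≡n zero          _  = refl
even⇒⌊n/2⌋*2≡n (suc (suc n)) pn = cong (λ m → suc (suc m)) (even⇒⌊n/2⌋*2≡n n pn)

even⇒1≤⌊n/2⌋ : ∀ n → parity n ≡ 0ℙ → 1 ≤ n → 1 ≤ ⌊ n /2⌋
even⇒1≤⌊n/2⌋ (suc (suc n)) _ _ = s≤s z≤n

1≤n⇒⌊n/2⌋<n : ∀ {n} → 1 ≤ n → ⌊ n /2⌋ < n
1≤n⇒⌊n/2⌋<n {suc n} _ = ⌊n/2⌋<n n

PairedAlong : (ℕ → ℤ) → ℕ → Set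
PairedAlong x s = ∀ m → parity m ≡ 1ℙ →
  IsSign (x (m ℕ.* s)) × x (m ℕ.* s) ℤ.+ x (suc m ℕ.* s) ≡ + 0

module _ (x : ℕ → ℤ) (s : ℕ) (paired : PairedAlong x s) where

  d-even≡0 : ∀ k → parity k ≡ 0ℙ → d x s k ≡ + 0
  d-even≡0 zero          _  = refl
  d-even≡0 (suc (suc k)) pk = begin
    d x s k ℤ.+ x (suc k ℕ.* s) ℤ.+ x (suc (suc k) ℕ.* s)
      ≡⟨ +-assoc (d x s k) _ _ ⟩
    d x s k ℤ.+ (x (suc k ℕ.* s) ℤ.+ x (suc (suc k) ℕ.* s))
      ≡⟨ cong₂ ℤ._+_ (d-even≡0 k pk) (proj₂ (paired (suc k) (parity-suc k pk))) ⟩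
    + 0 ∎
    where open ≡-Reasoning

  paired⇒disc≤1 : Disc≤1 x s
  paired⇒disc≤1 zero = z≤n
  paired⇒disc≤1 (suc k) with parity k in pk
  ... | 0ℙ rewrite d-even≡0 k pk | +-identityˡ (x (suc k ℕ.* s)) =
    IsSign⇒∣∣≤1 (proj₁ (paired (suc k) (parity-suc k pk)))
  ... | 1ℙ rewrite d-even≡0 (suc k) (parity-suc k pk) = z≤n

±1 : Parity → ℤ
±1 0ℙ = - + 1
±1 1ℙ = + 1

±1-sign : ∀ p → IsSign (±1 p)
±1-sign 0ℙ = inj₂ refl
±1-sign 1ℙ = inj₁ refl

±1-+-⁻¹ : ∀ p → ±1 p ℤ.+ ±1 (p ⁻¹) ≡ + 0
±1-+-⁻¹ 0ℙ = refl
±1-+-⁻¹ 1ℙ = refl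

alternating : ℕ → ℤ
alternating n = ±1 (parity n)

alternating-sign : ∀ n → IsSign (alternating n)
alternating-sign n = ±1-sign (parity n)

alternating-+-suc : ∀ m → alternating m ℤ.+ alternating (suc m) ≡ + 0
alternating-+-suc m rewrite parity-suc m refl = ±1-+-⁻¹ (parity m)

alternating-*-odd : ∀ {s} → parity s ≡ 1ℙ → ∀ m → alternating (m ℕ.* s) ≡ alternating m
alternating-*-odd ps m = cong ±1 (trans (parity-* m _ refl ps) (*-identityʳ (parity m)))

alternating-along⇒paired : ∀ x s → (∀ m → x (m ℕ.* s) ≡ alternating m) → PairedAlong x s
alternating-along⇒paired x s eq m _ =
  subst IsSign (sym (eq m)) (alternating-sign m) ,
  trans (cong₂ ℤ._+_ (eq m) (eq (suc m))) (alternating-+-suc m)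

alternating-disc≤1 : ∀ s → parity s ≡ 1ℙ → Disc≤1 alternating s
alternating-disc≤1 s ps =
  paired⇒disc≤1 alternating s (alternating-along⇒paired alternating s (alternating-*-odd ps))

colouring-odd-odd : ∀ {s t} → parity s ≡ 1ℙ → parity t ≡ 1ℙ → Colouring (s ∷ t ∷ [])
colouring-odd-odd {s} {t} ps pt =
  alternating , alternating-sign , alternating-disc≤1 s ps ∷ alternating-disc≤1 t pt ∷ []

-- Written s + n so that s + m * s is (m + 1) * s by definition.
interleave : (s t : ℕ) .{{_ : NonZero t}} → ℕ → ℤ
interleave s t n with parity n
... | 0ℙ = alternating (n / t)
... | 1ℙ = - alternating ((s ℕ.+ n) / t)

module _ (s t : ℕ) .{{_ : NonZero t}} where

  interleave-even : ∀ n → parity n ≡ 0ℙ → interleave s t n ≡ alternating (n / t)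
  interleave-even n pn rewrite pn = refl

  interleave-odd : ∀ n → parity n ≡ 1ℙ → interleave s t n ≡ - alternating ((s ℕ.+ n) / t)
  interleave-odd n pn rewrite pn = refl

  interleave-sign : ∀ n → IsSign (interleave s t n)
  interleave-sign n with parity n
  ... | 0ℙ = alternating-sign (n / t)
  ... | 1ℙ = IsSign-neg (alternating-sign ((s ℕ.+ n) / t))

colouring-odd-even : ∀ {s t} .{{_ : NonZero t}} → parity s ≡ 1ℙ → parity t ≡ 0ℙ →
  Colouring (s ∷ t ∷ [])
colouring-odd-even {s} {t} ps pt =
  interleave s t , interleave-sign s t ,
  paired⇒disc≤1 x s along-s ∷ paired⇒disc≤1 x t (alternating-along⇒paired x t along-t) ∷ []
  where
  x : ℕ → ℤ
  x = interleave s t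

  along-t : ∀ m → x (m ℕ.* t) ≡ alternating m
  along-t m = begin
    x (m ℕ.* t)
      ≡⟨ interleave-even s t (m ℕ.* t) (trans (parity-* m t refl pt) (*-zeroʳ (parity m))) ⟩
    alternating (m ℕ.* t / t)
      ≡⟨ cong alternating (m*n/n≡m m t) ⟩
    alternating m
      ∎
    where open ≡-Reasoning

  along-s : PairedAlong x s
  along-s m pm = subst IsSign (sym x-odd) (IsSign-neg (alternating-sign (suc m ℕ.* s / t))) ,
    (begin
      x (m ℕ.* s) ℤ.+ x (suc m ℕ.* s)  ≡⟨ cong₂ ℤ._+_ x-odd x-even ⟩
      - a ℤ.+ a                         ≡⟨ +-inverseˡ a ⟩
      + 0                               ∎)
    where
    open ≡-Reasoning
    a : ℤ
    a = alternating (suc m ℕ.* s / t)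
    x-odd : x (m ℕ.* s) ≡ - a
    x-odd = interleave-odd s t (m ℕ.* s) (parity-* m s pm ps)
    x-even : x (suc m ℕ.* s) ≡ a
    x-even = interleave-even s t (suc m ℕ.* s) (parity-* (suc m) s (parity-suc m pm) ps)

stretch : (c : ℕ) .{{_ : NonZero c}} → (ℕ → ℤ) → ℕ → ℤ
stretch c x n = x (n / c)

d-stretch : ∀ c .{{_ : NonZero c}} x s k → d (stretch c x) (s ℕ.* c) k ≡ d x s k
d-stretch c x s zero    = refl
d-stretch c x s (suc k) = cong₂ ℤ._+_ (d-stretch c x s k) (cong x (begin
  suc k ℕ.* (s ℕ.* c) / c   ≡⟨ cong (_/ c) (sym (*-assoc (suc k) s c)) ⟩
  suc k ℕ.* s ℕ.* c / c     ≡⟨ m*n/n≡m (suc k ℕ.* s) c ⟩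
  suc k ℕ.* s               ∎))
  where open ≡-Reasoning

colouring-stretch : ∀ c .{{_ : NonZero c}} {S} → Colouring S → Colouring (map (ℕ._* c) S)
colouring-stretch c (x , sign , disc) =
  stretch c x , (λ n → sign (n / c)) , map⁺ (All.map stretch-disc disc)
  where
  stretch-disc : ∀ {s} → Disc≤1 x s → Disc≤1 (stretch c x) (s ℕ.* c)
  stretch-disc {s} disc k rewrite d-stretch c x s k = disc k

colouring-swap : ∀ {s t} → Colouring (s ∷ t ∷ []) → Colouring (t ∷ s ∷ [])
colouring-swap (x , sign , ds ∷ dt ∷ []) = x , sign , dt ∷ ds ∷ []

colouring-acc : ∀ s t → 1 ≤ s → 1 ≤ t → Acc _<_ s → Colouring (s ∷ t ∷ [])
colouring-acc s t 1≤s 1≤t (acc rs) with parity s in ps | parity t in pt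
... | 1ℙ | 1ℙ = colouring-odd-odd ps pt
... | 1ℙ | 0ℙ = colouring-odd-even {{>-nonZero 1≤t}} ps pt
... | 0ℙ | 1ℙ = colouring-swap (colouring-odd-even {{>-nonZero 1≤s}} pt ps)
... | 0ℙ | 0ℙ =
  subst Colouring (cong₂ (λ a b → a ∷ b ∷ []) (even⇒⌊n/2⌋*2≡n s ps) (even⇒⌊n/2⌋*2≡n t pt))
    (colouring-stretch 2 (colouring-acc ⌊ s /2⌋ ⌊ t /2⌋
      (even⇒1≤⌊n/2⌋ s ps 1≤s) (even⇒1≤⌊n/2⌋ t pt 1≤t) (rs (1≤n⇒⌊n/2⌋<n 1≤s))))

colouring : ∀ s t → 1 ≤ s → 1 ≤ t → Colouring (s ∷ t ∷ [])
colouring s t 1≤s 1≤t = colouring-acc s t 1≤s 1≤t (<-wellFounded s)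

colouring-≤2 : ∀ S → length S ≤ 2 → All (1 ≤_) S → Colouring S
colouring-≤2 []          _ []            = alternating , alternating-sign , []
colouring-≤2 (s ∷ [])    _ (1≤s ∷ [])    with colouring s s 1≤s 1≤s
... | x , sign , disc ∷ _ = x , sign , disc ∷ []
colouring-≤2 (s ∷ t ∷ []) _ (1≤s ∷ 1≤t ∷ []) = colouring s t 1≤s 1≤t
colouring-≤2 (_ ∷ _ ∷ _ ∷ _) (s≤s (s≤s ())) _

theorem1 : (S : List ℕ) → length S ≤ 2 → All (λ s → 1 ≤ s) S →
    Σ (ℕ → ℤ) (λ x → IsSignSeq x ×
      (∀ s → s ∈ S → ∀ k → 1 ≤ k → ∣ d x s k ∣ ≤ 1))
theorem1 S |S|≤2 S-positive with colouring-≤2 S |S|≤2 S-positive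
... | x , sign , disc = x , (λ n → sign (suc n)) , λ s s∈S k _ → All.lookup disc s∈S k
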